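{- Let $t$ be a positive integer. For every graph $H$ in $\mathcal{L}_t$, there is a sequence $(a_1,\dots,a_t)$ with $a_1\in\{1,2\}$ and $a_{i+1}=3-a_i$ for $1\le i\le t-1$ such that $H$ is isomorphic to $L_{a_1,a_2,\dots,a_t}$.
   Context: Let $L_0$ be the graph obtained from a path on four vertices by adding two new vertices each adjacent to both ends of the path. $P_2$ denotes a path on two vertices and $C_4$ a cycle on four vertices. Set $\mathcal{L}_0=\{L_0\}$, and for $i\ge 1$ let $\mathcal{L}_i$ be the collection of triangle-free graphs of maximum degree at most three obtainable from some $H'\in\mathcal{L}_{i-1}$ by one of: (Operation 1) adding a disjoint copy of $P_2$ and two edges, one joining one end of the $P_2$ to a vertex of some $4$-cycle of $H'$ and the other joining the other end of the $P_2$ to the diagonally opposite vertex of the same $4$-cycle; (Operation 2) adding a disjoint copy of $C_4$ and two edges, one joining a vertex of the new $C_4$ to one end of some edge (copy of $P_2$) of $H'$, and the other joining the diagonally opposite vertex of the new $C_4$ to the other end of that edge. (Each operation applied to a graph in $\mathcal{L}_{i-1}$ involves the degree-two vertices, and there is at most one way up to isomorphism to perform it.) For a sequence $(a_1,\dots,a_k)$ with $a_i\in\{1,2\}$, $L_{a_1,\dots,a_k}$ denotes the graph (well defined up to isomorphism) obtained from $L_0$ by performing Operations $a_1,a_2,\dots,a_k$ consecutively. -}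

module Defs where

open import Data.Nat using (ℕ; zero; suc; _+_; _≤_)
open import Data.Fin using (Fin; splitAt; _≟_) renaming (zero to f0; suc to fs)
open import Data.Bool using (Bool; true; false; if_then_else_; _∨_; _∧_)
open import Data.List using (List; []; _∷_; _∷ʳ_; map; allFin)
open import Data.Nat.ListAction using (sum)
open import Data.Sum using (_⊎_; inj₁; inj₂)
open import Data.Product using (Σ; _×_; _,_)
open import Data.Unit using (⊤)
open import Data.Empty using (⊥)
open import Relation.Binary.PropositionalEquality using (_≡_; _≢_)
open import Relation.Nullary using (¬_)
open import Relation.Nullary.Decidable using (⌊_⌋)
open import Function.Bundles using (_↔_; Inverse)

-- All graphs constructed below (L₀ and the results of the two
-- operations) are symmetric and loopless by construction.
record Graph : Set where
  constructor mkGraph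
  field
    size : ℕ
    adj  : Fin size → Fin size → Bool
open Graph public

Adj : (G : Graph) → Fin (size G) → Fin (size G) → Set
Adj G x y = adj G x y ≡ true

TriangleFree : Graph → Set
TriangleFree G = ∀ x y z → Adj G x y → Adj G y z → Adj G x z → ⊥

degree : (G : Graph) → Fin (size G) → ℕ
degree G x = sum (map (λ y → if adj G x y then 1 else 0) (allFin (size G)))

MaxDegAtMost3 : Graph → Set
MaxDegAtMost3 G = ∀ x → degree G x ≤ 3

_≅_ : Graph → Graph → Set
G ≅ H = Σ (Fin (size G) ↔ Fin (size H)) λ f →
          ∀ x y → adj G x y ≡ adj H (Inverse.to f x) (Inverse.to f y)

-- L₀ : path 0-1-2-3, plus vertices 4 and 5 each adjacent to 0 and 3.
L0adj : Fin 6 → Fin 6 → Bool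
L0adj x y = e x y ∨ e y x
  where
  e : Fin 6 → Fin 6 → Bool
  e f0 (fs f0) = true
  e (fs f0) (fs (fs f0)) = true
  e (fs (fs f0)) (fs (fs (fs f0))) = true
  e (fs (fs (fs (fs f0)))) f0 = true
  e (fs (fs (fs (fs f0)))) (fs (fs (fs f0))) = true
  e (fs (fs (fs (fs (fs f0))))) f0 = true
  e (fs (fs (fs (fs (fs f0))))) (fs (fs (fs f0))) = true
  e _ _ = false

L0 : Graph
L0 = mkGraph 6 L0adj

-- Extension of a graph H by k new vertices (the first k vertices of
-- Fin (k + size H)), with adjacency `new` among the new vertices and
-- `cross i v` saying whether new vertex i is joined to old vertex v.
extend : (H : Graph) (k : ℕ) → (Fin k → Fin k → Bool) → (Fin k → Fin (size H) → Bool) → Graph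
extend H k new cross = mkGraph (k + size H) a
  where
  a : Fin (k + size H) → Fin (k + size H) → Bool
  a x y with splitAt k x | splitAt k y
  ... | inj₁ i | inj₁ j = new i j
  ... | inj₁ i | inj₂ v = cross i v
  ... | inj₂ v | inj₁ i = cross i v
  ... | inj₂ v | inj₂ w = adj H v w

P2adj : Fin 2 → Fin 2 → Bool
P2adj f0 (fs f0) = true
P2adj (fs f0) f0 = true
P2adj _ _ = false

op1Graph : (H : Graph) → Fin (size H) → Fin (size H) → Graph
op1Graph H u v = extend H 2 P2adj cross
  where
  cross : Fin 2 → Fin (size H) → Bool
  cross f0 w = ⌊ w ≟ u ⌋
  cross (fs _) w = ⌊ w ≟ v ⌋

C4adj : Fin 4 → Fin 4 → Bool
C4adj x y = e x y ∨ e y x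
  where
  e : Fin 4 → Fin 4 → Bool
  e f0 (fs f0) = true
  e (fs f0) (fs (fs f0)) = true
  e (fs (fs f0)) (fs (fs (fs f0))) = true
  e (fs (fs (fs f0))) f0 = true
  e _ _ = false

op2Graph : (H : Graph) → Fin (size H) → Fin (size H) → Graph
op2Graph H u v = extend H 4 C4adj cross
  where
  cross : Fin 4 → Fin (size H) → Bool
  cross f0 w = ⌊ w ≟ u ⌋
  cross (fs (fs f0)) w = ⌊ w ≟ v ⌋
  cross _ _ = false

data Op : Set where
  op1 op2 : Op

-- a ↦ 3 - a on {1,2}
flipOp : Op → Op
flipOp op1 = op2
flipOp op2 = op1

OppositeIn4Cycle : (H : Graph) → Fin (size H) → Fin (size H) → Set
OppositeIn4Cycle H u v = Σ (Fin (size H)) λ w → Σ (Fin (size H)) λ x →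
  (u ≢ w) × (u ≢ v) × (u ≢ x) × (w ≢ v) × (w ≢ x) × (v ≢ x) ×
  Adj H u w × Adj H w v × Adj H v x × Adj H x u

data Step : Op → Graph → Graph → Set where
  step1 : ∀ {H} u v → OppositeIn4Cycle H u v → Step op1 H (op1Graph H u v)
  step2 : ∀ {H} u v → Adj H u v → Step op2 H (op2Graph H u v)

data Derives : List Op → Graph → Set where
  base : Derives [] L0
  next : ∀ {as o H G} → Derives as H → Step o H G →
         TriangleFree G → MaxDegAtMost3 G → Derives (as ∷ʳ o) G

InL : ℕ → Graph → Set
InL i G = Σ (List Op) λ as → (Data.List.length as ≡ i) × Derives as G

Alternating : List Op → Set
Alternating [] = ⊤
Alternating (a ∷ []) = ⊤
Alternating (a ∷ b ∷ rest) = (b ≡ flipOp a) × Alternating (b ∷ rest)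

module Submission where

-- All graphs in 𝓛ᵢ are ladders.  A ladder has two vertices (sides) per
-- layer; the layer types repeat P, A, B, so that it is a chain of blocks:
-- P₂-blocks (one P-layer, whose two vertices form a rung) alternating with
-- C₄-blocks (an A-layer completely joined to the following B-layer), with
-- perfect matchings between consecutive blocks.  L₀ is the ladder P A B.
-- A ladder is determined by its first block and its number of layers.
--
-- Conversely, interior vertices of a ladder already have degree three, so
-- an operation keeping the maximum degree ≤ 3 must attach to an end layer;
-- hence each derivation step adds one block at the bottom or at the top
-- (step-ladder) and every graph of 𝓛_t is a ladder of t + 2 blocks.
-- Finally the alternating sequence starting with operation 1 (resp. 2)
-- derives the ladder of t + 2 blocks whose first block is a P₂ (resp. a
-- C₄), and graphs with the same ladder structure are isomorphic.

open import Defs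
open import Algebra.Properties.CommutativeSemigroup using (interchange)
open import Data.Bool using (Bool; true; false; not; _∨_; _∧_; if_then_else_)
open import Data.Bool.Properties using (∧-identityʳ) renaming (_≟_ to _≟B_)
open import Data.Empty using (⊥; ⊥-elim)
open import Data.Fin using (Fin; _≟_; splitAt; join) renaming (zero to f0; suc to fs)
open import Data.Fin.Properties using (suc-injective; splitAt-join; join-splitAt; all?)
open import Data.List using (List; []; _∷_; _∷ʳ_; _++_; length; map; tabulate)
open import Data.List.Properties using (length-++; ++-assoc; ++-identityʳ)
open import Data.Nat using (ℕ; zero; suc; _+_; _∸_; _≤_; _<_; z≤n; s≤s; _<?_) renaming (_≟_ to _≟ℕ_)
open import Data.Nat.ListAction using (sum)
open import Data.Nat.Properties
  using (≤-refl; ≤-trans; ≤-pred; <-irrefl; m<n⇒m<1+n; ≤∧≢⇒<; 1+n≢n; +-suc; +-identityʳ; +-mono-≤; m≤n+m;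
         +-comm; +-assoc; +-commutativeSemigroup)
open import Data.Product using (Σ; _×_; _,_; proj₁; proj₂)
open import Data.Product.Properties using (≡-dec)
open import Data.Sum using (_⊎_; inj₁; inj₂; [_,_]′)
open import Data.Unit using (tt)
open import Function using (_∘_)
open import Function.Bundles using (mk↔ₛ′)
open import Relation.Binary.PropositionalEquality
open import Relation.Nullary using (¬_; Dec; does; yes; no)
open import Relation.Nullary.Decidable using (⌊_⌋; isYes≗does; dec-true; dec-false; recompute; toWitness)

-- The two sides of a layer are named by booleans; `same` is boolean equality.
same : Bool → Bool → Bool
same true  true  = true
same false false = true
same _     _     = false

same-refl : ∀ s → same s s ≡ true
same-refl true  = refl
same-refl false = refl

same-sym : ∀ s s' → same s s' ≡ same s' s
same-sym true  true  = refl
same-sym true  false = refl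
same-sym false true  = refl
same-sym false false = refl

same⇒≡ : ∀ {s s'} → same s s' ≡ true → s ≡ s'
same⇒≡ {true}  {true}  _ = refl
same⇒≡ {false} {false} _ = refl

different⇒not : ∀ {s s'} → same s s' ≡ false → s' ≡ not s
different⇒not {true}  {false} _ = refl
different⇒not {false} {true}  _ = refl

same-not : ∀ s → same s (not s) ≡ false
same-not true  = refl
same-not false = refl

false≢true : false ≡ true → ⊥
false≢true ()

not-fixed : ∀ {s} → s ≡ not s → ⊥
not-fixed {true}  ()
not-fixed {false} ()

-- In the ladders below the types repeat P, A, B, P, A, B, …:
-- a P-layer carries a rung joining its two sides (a copy of P₂), an A-layer
-- and the following B-layer together span a copy of C₄ = K₂,₂.
data Ty : Set where
  P A B : Ty

nextTy : Ty → Ty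
nextTy P = A
nextTy A = B
nextTy B = P

typeAt : Ty → ℕ → Ty
typeAt t zero    = t
typeAt t (suc m) = typeAt (nextTy t) m

typeAt-suc : ∀ t m → typeAt t (suc m) ≡ nextTy (typeAt t m)
typeAt-suc t zero    = refl
typeAt-suc t (suc m) = typeAt-suc (nextTy t) m

rung : Ty → Bool → Bool → Bool
rung P s s' = not (same s s')
rung _ _ _  = false

link : Ty → Bool → Bool → Bool
link A _ _  = true
link _ s s' = same s s'

-- Adjacency in the infinite ladder whose layer 0 has type t; vertices are
-- pairs (layer, side).  Only equal or consecutive layers are joined;
-- `fromBottom` lists the neighbours of the vertices of layer 0.
fromBottom : Ty → Bool → ℕ → Bool → Bool
fromBottom t s zero          s' = rung t s s'
fromBottom t s (suc zero)    s' = link t s s'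
fromBottom t s (suc (suc _)) s' = false

ladderAdj : Ty → ℕ → Bool → ℕ → Bool → Bool
ladderAdj t zero    s m'       s' = fromBottom t s m' s'
ladderAdj t (suc m) s zero     s' = fromBottom t s' (suc m) s
ladderAdj t (suc m) s (suc m') s' = ladderAdj (nextTy t) m s m' s'

ladder-same : ∀ t m s s' → ladderAdj t m s m s' ≡ rung (typeAt t m) s s'
ladder-same t zero    s s' = refl
ladder-same t (suc m) s s' = ladder-same (nextTy t) m s s'

ladder-up : ∀ t m s s' → ladderAdj t m s (suc m) s' ≡ link (typeAt t m) s s'
ladder-up t zero    s s' = refl
ladder-up t (suc m) s s' = ladder-up (nextTy t) m s s'

ladder-down : ∀ t m s s' → ladderAdj t (suc m) s m s' ≡ link (typeAt t m) s' s
ladder-down t zero    s s' = refl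
ladder-down t (suc m) s s' = ladder-down (nextTy t) m s s'

ladder-far : ∀ t {m} n s s' → m ≤ n → ladderAdj t (suc (suc n)) s m s' ≡ false
ladder-far t n       s s' z≤n       = refl
ladder-far t (suc n) s s' (s≤s m≤n) = ladder-far (nextTy t) n s s' m≤n

rung-sym : ∀ τ s s' → rung τ s s' ≡ rung τ s' s
rung-sym P s s' = cong not (same-sym s s')
rung-sym A s s' = refl
rung-sym B s s' = refl

ladder-sym : ∀ t m s m' s' → ladderAdj t m s m' s' ≡ ladderAdj t m' s' m s
ladder-sym t zero    s zero     s' = rung-sym t s s'
ladder-sym t zero    s (suc m') s' = refl
ladder-sym t (suc m) s zero     s' = refl
ladder-sym t (suc m) s (suc m') s' = ladder-sym (nextTy t) m s m' s'

ladder-far' : ∀ t {m} n s s' → m ≤ n → ladderAdj t m s (suc (suc n)) s' ≡ false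
ladder-far' t {m} n s s' m≤n = trans (ladder-sym t m s (suc (suc n)) s') (ladder-far t n s' s m≤n)

data Near (m m' : ℕ) : Set where
  same-layer : m' ≡ m     → Near m m'
  layer-up   : m' ≡ suc m → Near m m'
  layer-down : m ≡ suc m' → Near m m'

near-suc : ∀ {m m'} → Near m m' → Near (suc m) (suc m')
near-suc (same-layer e) = same-layer (cong suc e)
near-suc (layer-up e)   = layer-up (cong suc e)
near-suc (layer-down e) = layer-down (cong suc e)

ladder-near : ∀ t m s m' s' → ladderAdj t m s m' s' ≡ true → Near m m'
ladder-near t zero       s zero       s' e = same-layer refl
ladder-near t zero       s (suc zero) s' e = layer-up refl
ladder-near t (suc zero) s zero       s' e = layer-down refl
ladder-near t (suc m)    s (suc m')   s' e = near-suc (ladder-near (nextTy t) m s m' s' e)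

rung-true : ∀ τ s s' → rung τ s s' ≡ true → (τ ≡ P) × (s' ≡ not s)
rung-true P true  false _ = refl , refl
rung-true P false true  _ = refl , refl

Matched : Ty → Set
Matched τ = τ ≡ P ⊎ τ ≡ B

matching : ∀ {τ s s'} → Matched τ → link τ s s' ≡ true → s ≡ s'
matching (inj₁ refl) e = same⇒≡ e
matching (inj₂ refl) e = same⇒≡ e

nextTy-injective : ∀ {τ τ'} → nextTy τ ≡ nextTy τ' → τ ≡ τ'
nextTy-injective {P} {P} _ = refl
nextTy-injective {A} {A} _ = refl
nextTy-injective {B} {B} _ = refl

typeAt-pred : ∀ t m {τ} → typeAt t (suc m) ≡ nextTy τ → typeAt t m ≡ τ
typeAt-pred t m e = nextTy-injective (trans (sym (typeAt-suc t m)) e)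

rung-common : ∀ t m s s' a sa → typeAt t m ≡ P →
  ladderAdj t a sa m s ≡ true → ladderAdj t a sa m s' ≡ true → s ≡ s'
rung-common t m s s' a sa isP as as' with ladder-near t a sa m s as
... | same-layer refl = trans (opposite as) (sym (opposite as'))
  where
  opposite : ∀ {s} → ladderAdj t a sa a s ≡ true → s ≡ not sa
  opposite {s} e = proj₂ (rung-true (typeAt t a) sa s (trans (sym (ladder-same t a sa s)) e))
... | layer-up refl = trans (sym (matched as)) (matched as')
  where
  matched : ∀ {s} → ladderAdj t a sa (suc a) s ≡ true → sa ≡ s
  matched {s} e = matching (inj₂ (typeAt-pred t a isP)) (trans (sym (ladder-up t a sa s)) e)
... | layer-down refl = trans (matched as) (sym (matched as'))
  where
  matched : ∀ {s} → ladderAdj t (suc m) sa m s ≡ true → s ≡ sa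
  matched {s} e = matching (inj₁ isP) (trans (sym (ladder-down t m sa s)) e)

rung-triangle-free : ∀ t m s s' a sa → ladderAdj t m s m s' ≡ true →
  ladderAdj t a sa m s ≡ true → ladderAdj t a sa m s' ≡ true → ⊥
rung-triangle-free t m s s' a sa ss' as as' =
  not-fixed (trans (rung-common t m s s' a sa isP as as') s'≡not-s)
  where
  rungFacts = rung-true (typeAt t m) s s' (trans (sym (ladder-same t m s s')) ss')
  isP = proj₁ rungFacts
  s'≡not-s = proj₂ rungFacts

-- The ladder is triangle-free: a triangle has two vertices in one layer
-- (vertices three layers apart are never all pairwise adjacent), and these
-- form a rung whose ends would have a common neighbour.
ladder-triangle-free : ∀ t mx sx my sy mz sz → ladderAdj t mx sx my sy ≡ true →
  ladderAdj t my sy mz sz ≡ true → ladderAdj t mx sx mz sz ≡ true → ⊥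
ladder-triangle-free t mx sx my sy mz sz xy yz xz with ladder-near t mx sx my sy xy
... | same-layer refl =
  rung-triangle-free t mx sx sy mz sz xy (trans (ladder-sym t mz sz mx sx) xz) (trans (ladder-sym t mz sz mx sy) yz)
ladder-triangle-free t mx sx .(suc mx) sy mz sz xy yz xz | layer-up refl with ladder-near t mx sx mz sz xz
... | same-layer refl = rung-triangle-free t mx sx sz (suc mx) sy xz (trans (ladder-sym t (suc mx) sy mx sx) xy) yz
... | layer-up refl   = rung-triangle-free t (suc mx) sy sz mx sx yz xy xz
... | layer-down refl = false≢true (trans (sym (ladder-far t mz sy sz ≤-refl)) yz)
ladder-triangle-free t .(suc my) sx my sy mz sz xy yz xz | layer-down refl with ladder-near t (suc my) sx mz sz xz
... | same-layer refl = rung-triangle-free t (suc my) sx sz my sy xz (trans (ladder-sym t my sy (suc my) sx) xy) yz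
... | layer-up refl   = false≢true (trans (sym (ladder-far' t my sy sz ≤-refl)) yz)
... | layer-down refl = rung-triangle-free t my sy sz (suc my) sx yz xy xz

indicator : Bool → ℕ
indicator b = if b then 1 else 0

count : (n : ℕ) → (Fin n → Bool) → ℕ
count zero    f = 0
count (suc n) f = indicator (f f0) + count n (f ∘ fs)

degree-count : ∀ G x → degree G x ≡ count (size G) (adj G x)
degree-count G x = sum-tabulate (size G) (λ i → i) (adj G x)
  where
  sum-tabulate : ∀ {X : Set} n (h : Fin n → X) (f : X → Bool) →
    sum (map (indicator ∘ f) (tabulate h)) ≡ count n (f ∘ h)
  sum-tabulate zero    h f = refl
  sum-tabulate (suc n) h f = cong (indicator (f (h f0)) +_) (sum-tabulate n (h ∘ fs) f)

count-cong : ∀ n {f g : Fin n → Bool} → (∀ y → f y ≡ g y) → count n f ≡ count n g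
count-cong zero    e = refl
count-cong (suc n) e = cong₂ (λ b c → indicator b + c) (e f0) (count-cong n (e ∘ fs))

count-mono : ∀ n (f g : Fin n → Bool) → (∀ y → f y ≡ true → g y ≡ true) → count n f ≤ count n g
count-mono zero    f g h = z≤n
count-mono (suc n) f g h with f f0 in e
... | true rewrite h f0 e = s≤s (count-mono n _ _ (h ∘ fs))
... | false = ≤-trans (count-mono n _ _ (h ∘ fs)) (m≤n+m _ (indicator (g f0)))

count-∨ : ∀ n (f g : Fin n → Bool) → count n (λ y → f y ∨ g y) ≤ count n f + count n g
count-∨ zero    f g = z≤n
count-∨ (suc n) f g = subst (count (suc n) (λ y → f y ∨ g y) ≤_)
  (interchange +-commutativeSemigroup (indicator (f f0)) (indicator (g f0)) (count n (f ∘ fs)) (count n (g ∘ fs)))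
  (+-mono-≤ (indicator-∨ (f f0) (g f0)) (count-∨ n (f ∘ fs) (g ∘ fs)))
  where
  indicator-∨ : ∀ a b → indicator (a ∨ b) ≤ indicator a + indicator b
  indicator-∨ true  b     = s≤s z≤n
  indicator-∨ false true  = s≤s z≤n
  indicator-∨ false false = z≤n

count-false : ∀ n (f : Fin n → Bool) → (∀ y → f y ≡ false) → count n f ≡ 0
count-false zero    f e = refl
count-false (suc n) f e rewrite e f0 = count-false n _ (e ∘ fs)

AtMostOnce : ∀ {n} → (Fin n → Bool) → Set
AtMostOnce f = ∀ y y' → f y ≡ true → f y' ≡ true → y ≡ y'

count-atMostOnce : ∀ n (f : Fin n → Bool) → AtMostOnce f → count n f ≤ 1
count-atMostOnce zero    f once = z≤n
count-atMostOnce (suc n) f once with f f0 in e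
... | true = subst (λ k → suc k ≤ 1) (sym (count-false n (f ∘ fs) rest)) (s≤s z≤n)
  where
  rest : ∀ y → f (fs y) ≡ false
  rest y with f (fs y) in e'
  ... | false = refl
  ... | true with once _ _ e e'
  ... | ()
... | false = count-atMostOnce n _ (λ y y' p q → suc-injective (once _ _ p q))

remove : ∀ {n} → (Fin n → Bool) → Fin n → Fin n → Bool
remove f a y = f y ∧ not (does (y ≟ a))

count-remove : ∀ n (f : Fin n → Bool) a → f a ≡ true → count n f ≡ suc (count n (remove f a))
count-remove (suc n) f f0 e rewrite e = cong suc (count-cong n (λ y → sym (∧-identityʳ (f (fs y)))))
count-remove (suc n) f (fs a) e rewrite ∧-identityʳ (f f0) =
  trans (cong (indicator (f f0) +_) (count-remove n (f ∘ fs) a e)) (+-suc (indicator (f f0)) _)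

remove-keeps : ∀ {n} (f : Fin n → Bool) {a b} → a ≢ b → f b ≡ true → remove f a b ≡ true
remove-keeps f {a} {b} a≢b e rewrite dec-false (b ≟ a) (a≢b ∘ sym) | e = refl

count-four : ∀ n (f : Fin n → Bool) a b c d →
  a ≢ b → a ≢ c → a ≢ d → b ≢ c → b ≢ d → c ≢ d →
  f a ≡ true → f b ≡ true → f c ≡ true → f d ≡ true → 4 ≤ count n f
count-four n f a b c d ab ac ad bc bd cd fa fb fc fd =
  subst (4 ≤_) (sym (count-remove n f a fa))
  (s≤s (subst (3 ≤_) (sym (count-remove n f₁ b fb₁))
  (s≤s (subst (2 ≤_) (sym (count-remove n f₂ c fc₂))
  (s≤s (subst (1 ≤_) (sym (count-remove n f₃ d fd₃)) (s≤s z≤n)))))))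
  where
  f₁ = remove f a
  f₂ = remove f₁ b
  f₃ = remove f₂ c
  fb₁ = remove-keeps f ab fb
  fc₂ = remove-keeps f₁ bc (remove-keeps f ac fc)
  fd₃ = remove-keeps f₂ cd (remove-keeps f₁ bd (remove-keeps f ad fd))

∨₃-intro : ∀ {a b c} → a ≡ true ⊎ (b ≡ true ⊎ c ≡ true) → (a ∨ (b ∨ c)) ≡ true
∨₃-intro {true}          _               = refl
∨₃-intro {false} {true}  _               = refl
∨₃-intro {false} {false} (inj₂ (inj₂ e)) = e

count-three : ∀ n (f g₁ g₂ g₃ : Fin n → Bool) →
  AtMostOnce g₁ → AtMostOnce g₂ → AtMostOnce g₃ →
  (∀ y → f y ≡ true → g₁ y ≡ true ⊎ (g₂ y ≡ true ⊎ g₃ y ≡ true)) → count n f ≤ 3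
count-three n f g₁ g₂ g₃ once₁ once₂ once₃ covered =
  ≤-trans (count-mono n f _ (λ y e → ∨₃-intro {g₁ y} {g₂ y} {g₃ y} (covered y e)))
  (≤-trans (count-∨ n g₁ _)
  (+-mono-≤ (count-atMostOnce n g₁ once₁)
            (≤-trans (count-∨ n g₂ g₃) (+-mono-≤ (count-atMostOnce n g₂ once₂) (count-atMostOnce n g₃ once₃)))))

-- A vertex of the ladder with L layers.  The bound is irrelevant, so a
-- vertex is determined by its layer and side.
record Vertex (L : ℕ) : Set where
  constructor vtx
  field
    layer : ℕ
    side  : Bool
    .bounded : layer < L
open Vertex public

vertex-≡ : ∀ {L} {v w : Vertex L} → layer v ≡ layer w → side v ≡ side w → v ≡ w
vertex-≡ {v = vtx m s _} {vtx .m .s _} refl refl = refl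

layer< : ∀ {L} (v : Vertex L) → layer v < L
layer< {L} (vtx m s m<L) = recompute (m <? L) m<L

adjV : ∀ {L} → Ty → Vertex L → Vertex L → Bool
adjV t v w = ladderAdj t (layer v) (side v) (layer w) (side w)

-- H is (isomorphic to) the ladder with L layers whose layer 0 has type t.
record IsLadder (H : Graph) (t : Ty) (L : ℕ) : Set where
  field
    pos          : Fin (size H) → Vertex L
    vertexAt     : Vertex L → Fin (size H)
    vertexAt-pos : ∀ x → vertexAt (pos x) ≡ x
    pos-vertexAt : ∀ v → pos (vertexAt v) ≡ v
    adj-pos      : ∀ x y → adj H x y ≡ adjV t (pos x) (pos y)

  pos-injective : ∀ {x y} → pos x ≡ pos y → x ≡ y
  pos-injective {x} {y} e = trans (sym (vertexAt-pos x)) (trans (cong vertexAt e) (vertexAt-pos y))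

  vertexAt-injective : ∀ {v w} → vertexAt v ≡ vertexAt w → v ≡ w
  vertexAt-injective {v} {w} e = trans (sym (pos-vertexAt v)) (trans (cong pos e) (pos-vertexAt w))

  adj-vertexAt : ∀ v w → adj H (vertexAt v) (vertexAt w) ≡ adjV t v w
  adj-vertexAt v w rewrite adj-pos (vertexAt v) (vertexAt w) | pos-vertexAt v | pos-vertexAt w = refl

ladder-iso : ∀ {H G t L} → IsLadder H t L → IsLadder G t L → H ≅ G
ladder-iso {H} {G} RH RG = mk↔ₛ′ to from to-from from-to , to-adj
  where
  module RH = IsLadder RH
  module RG = IsLadder RG
  to : Fin (size H) → Fin (size G)
  to x = RG.vertexAt (RH.pos x)
  from : Fin (size G) → Fin (size H)
  from y = RH.vertexAt (RG.pos y)
  to-from : ∀ y → to (from y) ≡ y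
  to-from y rewrite RH.pos-vertexAt (RG.pos y) = RG.vertexAt-pos y
  from-to : ∀ x → from (to x) ≡ x
  from-to x rewrite RG.pos-vertexAt (RH.pos x) = RH.vertexAt-pos x
  to-adj : ∀ x y → adj H x y ≡ adj G (to x) (to y)
  to-adj x y = trans (RH.adj-pos x y) (sym (RG.adj-vertexAt (RH.pos x) (RH.pos y)))

ladder⇒triangle-free : ∀ {G t L} → IsLadder G t L → TriangleFree G
ladder⇒triangle-free {G} {t} R x y z xy yz xz =
  ladder-triangle-free t (layer (pos x)) (side (pos x)) (layer (pos y)) (side (pos y)) (layer (pos z)) (side (pos z))
    (inLadder x y xy) (inLadder y z yz) (inLadder x z xz)
  where
  open IsLadder R
  inLadder : ∀ a b → adj G a b ≡ true → adjV t (pos a) (pos b) ≡ true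
  inLadder a b e = trans (sym (adj-pos a b)) e

Coord : Set
Coord = ℕ × Bool

-- The three possible neighbours of the vertex (m, s) of a layer of type τ:
-- a P-layer has its rung partner and the matched vertices below and above,
-- an A-layer (resp. B-layer) the matched vertex below (above) and both
-- vertices of the C₄-partner layer above (below).

nbr₁ nbr₂ nbr₃ : Ty → ℕ → Bool → Coord
nbr₁ P m s = m , not s
nbr₁ A m s = m ∸ 1 , s
nbr₁ B m s = m ∸ 1 , s
nbr₂ P m s = m ∸ 1 , s
nbr₂ A m s = suc m , s
nbr₂ B m s = m ∸ 1 , not s
nbr₃ P m s = suc m , s
nbr₃ A m s = suc m , not s
nbr₃ B m s = suc m , s

IsNbr : Ty → ℕ → Bool → Coord → Set
IsNbr τ m s c = c ≡ nbr₁ τ m s ⊎ (c ≡ nbr₂ τ m s ⊎ c ≡ nbr₃ τ m s)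

ladder-neighbour : ∀ t m s m' s' → ladderAdj t m s m' s' ≡ true → IsNbr (typeAt t m) m s (m' , s')
ladder-neighbour t m s m' s' e with ladder-near t m s m' s' e
... | same-layer refl = inLayer (typeAt t m) s s' (trans (sym (ladder-same t m s s')) e)
  where
  inLayer : ∀ τ s s' → rung τ s s' ≡ true → IsNbr τ m s (m , s')
  inLayer τ s s' r with rung-true τ s s' r
  ... | refl , refl = inj₁ refl
... | layer-up refl = above (typeAt t m) s s' (trans (sym (ladder-up t m s s')) e)
  where
  above : ∀ τ s s' → link τ s s' ≡ true → IsNbr τ m s (suc m , s')
  above P s s' l rewrite same⇒≡ l = inj₂ (inj₂ refl)
  above B s s' l rewrite same⇒≡ l = inj₂ (inj₂ refl)
  above A true  true  l = inj₂ (inj₁ refl)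
  above A false false l = inj₂ (inj₁ refl)
  above A true  false l = inj₂ (inj₂ refl)
  above A false true  l = inj₂ (inj₂ refl)
ladder-neighbour t .(suc m') s m' s' e | layer-down refl
  rewrite typeAt-suc t m' = below (typeAt t m') s s' (trans (sym (ladder-down t m' s s')) e)
  where
  below : ∀ τ s s' → link τ s' s ≡ true → IsNbr (nextTy τ) (suc m') s (m' , s')
  below B s s' l rewrite same⇒≡ l = inj₂ (inj₁ refl)
  below P s s' l rewrite same⇒≡ l = inj₁ refl
  below A true  true  l = inj₁ refl
  below A false false l = inj₁ refl
  below A true  false l = inj₂ (inj₁ refl)
  below A false true  l = inj₂ (inj₁ refl)

does⇒ : ∀ {X : Set} (d : Dec X) → does d ≡ true → X
does⇒ (yes x) _ = x

-- Every vertex of a ladder has degree at most three: each neighbour sits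
-- at one of the three candidate positions, each occupied by one vertex.
ladder⇒maxDeg3 : ∀ {G t L} → IsLadder G t L → MaxDegAtMost3 G
ladder⇒maxDeg3 {G} {t} R x = subst (_≤ 3) (sym (degree-count G x))
  (count-three (size G) (adj G x) (at (nbr₁ τ m s)) (at (nbr₂ τ m s)) (at (nbr₃ τ m s))
    (at-once _) (at-once _) (at-once _) located)
  where
  open IsLadder R
  m = layer (pos x)
  s = side (pos x)
  τ = typeAt t m
  coord : Fin (size G) → Coord
  coord y = layer (pos y) , side (pos y)
  _≟C_ = ≡-dec _≟ℕ_ _≟B_
  at : Coord → Fin (size G) → Bool
  at c y = does (coord y ≟C c)
  at-once : ∀ c → AtMostOnce (at c)
  at-once c y y' e e' with does⇒ (coord y ≟C c) e | does⇒ (coord y' ≟C c) e'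
  ... | refl | eq = pos-injective (vertex-≡ (cong proj₁ (sym eq)) (cong proj₂ (sym eq)))
  located : ∀ y → adj G x y ≡ true →
    at (nbr₁ τ m s) y ≡ true ⊎ (at (nbr₂ τ m s) y ≡ true ⊎ at (nbr₃ τ m s) y ≡ true)
  located y e with ladder-neighbour t m s _ _ (trans (sym (adj-pos x y)) e)
  ... | inj₁ c        = inj₁ (dec-true (coord y ≟C nbr₁ τ m s) c)
  ... | inj₂ (inj₁ c) = inj₂ (inj₁ (dec-true (coord y ≟C nbr₂ τ m s) c))
  ... | inj₂ (inj₂ c) = inj₂ (inj₂ (dec-true (coord y ≟C nbr₃ τ m s) c))

adjV-sym : ∀ {L} t (v w : Vertex L) → adjV t v w ≡ adjV t w v
adjV-sym t v w = ladder-sym t (layer v) (side v) (layer w) (side w)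

-- A bijection between Fin k ⊎ Vertex L and Vertex L': positions of k new
-- vertices together with an embedding of the old ladder, jointly hitting
-- every position of the larger ladder exactly once.
record Placement (k L L' : ℕ) : Set where
  field
    newPos          : Fin k → Vertex L'
    shift           : Vertex L → Vertex L'
    classify        : Vertex L' → Fin k ⊎ Vertex L
    classify-newPos : ∀ i → classify (newPos i) ≡ inj₁ i
    classify-shift  : ∀ v → classify (shift v) ≡ inj₂ v
    place-classify  : ∀ z → [ newPos , shift ]′ (classify z) ≡ z

module Extension {H : Graph} {t t' : Ty} {L L' k : ℕ} (R : IsLadder H t L) (Pl : Placement k L L') where
  open IsLadder R
  open Placement Pl

  extend-ladder : ∀ {new : Fin k → Fin k → Bool} {cross : Fin k → Fin (size H) → Bool} →
    (∀ v w → adjV t v w ≡ adjV t' (shift v) (shift w)) →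
    (∀ i j → new i j ≡ adjV t' (newPos i) (newPos j)) →
    (∀ i w → cross i w ≡ adjV t' (newPos i) (shift (pos w))) →
    IsLadder (extend H k new cross) t' L'
  extend-ladder {new} {cross} shift-ok new-ok cross-ok = record
    { pos = pos' ; vertexAt = vertexAt' ; vertexAt-pos = vertexAt-pos' ; pos-vertexAt = pos-vertexAt' ; adj-pos = adj-pos' }
    where
    n = size H
    place : Fin k ⊎ Fin n → Vertex L'
    place = [ newPos , shift ∘ pos ]′
    pos' : Fin (k + n) → Vertex L'
    pos' x = place (splitAt k x)
    unclassify : Fin k ⊎ Vertex L → Fin k ⊎ Fin n
    unclassify = [ inj₁ , inj₂ ∘ vertexAt ]′
    vertexAt' : Vertex L' → Fin (k + n)
    vertexAt' z = join k n (unclassify (classify z))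

    unplace : ∀ e → unclassify (classify (place e)) ≡ e
    unplace (inj₁ i) rewrite classify-newPos i = refl
    unplace (inj₂ w) rewrite classify-shift (pos w) | vertexAt-pos w = refl

    vertexAt-pos' : ∀ x → vertexAt' (pos' x) ≡ x
    vertexAt-pos' x = trans (cong (join k n) (unplace (splitAt k x))) (join-splitAt k n x)

    place-unclassify : ∀ e → place (unclassify e) ≡ [ newPos , shift ]′ e
    place-unclassify (inj₁ i) = refl
    place-unclassify (inj₂ v) = cong shift (pos-vertexAt v)

    pos-vertexAt' : ∀ z → pos' (vertexAt' z) ≡ z
    pos-vertexAt' z = begin
      place (splitAt k (join k n (unclassify (classify z)))) ≡⟨ cong place (splitAt-join k n (unclassify (classify z))) ⟩
      place (unclassify (classify z))                        ≡⟨ place-unclassify (classify z) ⟩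
      [ newPos , shift ]′ (classify z)                       ≡⟨ place-classify z ⟩
      z ∎
      where open ≡-Reasoning

    adj-pos' : ∀ x y → adj (extend H k new cross) x y ≡ adjV t' (pos' x) (pos' y)
    adj-pos' x y with splitAt k x | splitAt k y
    ... | inj₁ i | inj₁ j = new-ok i j
    ... | inj₁ i | inj₂ w = cross-ok i w
    ... | inj₂ w | inj₁ i = trans (cross-ok i w) (adjV-sym t' (newPos i) (shift (pos w)))
    ... | inj₂ v | inj₂ w = trans (adj-pos v w) (shift-ok (pos v) (pos w))

-- The old ladder sits unchanged below new top layers, or moved up by one
-- layer below a new bottom layer.
widen : ∀ {L} → Vertex L → Vertex (suc L)
widen v = vtx (layer v) (side v) (m<n⇒m<1+n (layer< v))

raise : ∀ {L} → Vertex L → Vertex (suc L)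
raise v = vtx (suc (layer v)) (side v) (s≤s (layer< v))

-- The new vertex on side s of a new layer whose vertex i lies on side su
-- and whose vertex j lies on the other side.
pickSide : ∀ {k} → Bool → Fin k → Fin k → Bool → Fin k
pickSide su i j s = if same s su then i else j

pickSide-su : ∀ {k} su (i j : Fin k) → pickSide su i j su ≡ i
pickSide-su su i j rewrite same-refl su = refl

pickSide-not : ∀ {k} su (i j : Fin k) → pickSide su i j (not su) ≡ j
pickSide-not su i j rewrite same-sym (not su) su | same-not su = refl

pickSide-correct : ∀ {k} {X : Set} (f : Fin k → X) (g : Bool → X) su {i j} →
  f i ≡ g su → f j ≡ g (not su) → ∀ s → f (pickSide su i j s) ≡ g s
pickSide-correct f g su fi fj s with same s su in e
... | true  = trans fi (cong g (sym (same⇒≡ e)))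
... | false = trans fj (cong g (sym (different⇒not (trans (same-sym su s) e))))

p2Side : Bool → Fin 2 → Bool
p2Side su f0     = su
p2Side su (fs _) = not su

p2Pos : ∀ {L} ℓ → ℓ < L → Bool → Fin 2 → Vertex L
p2Pos ℓ ℓ< su i = vtx ℓ (p2Side su i) ℓ<

P₂-rung : ∀ {L} t ℓ (ℓ< : ℓ < L) su → typeAt t ℓ ≡ P →
  ∀ i j → P2adj i j ≡ adjV t (p2Pos ℓ ℓ< su i) (p2Pos ℓ ℓ< su j)
P₂-rung t ℓ ℓ< su isP i j =
  trans (P₂-sides su i j) (sym (trans (ladder-same t ℓ _ _) (cong (λ τ → rung τ _ _) isP)))
  where
  P₂-sides : ∀ su i j → P2adj i j ≡ rung P (p2Side su i) (p2Side su j)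
  P₂-sides true  f0      f0      = refl
  P₂-sides true  f0      (fs f0) = refl
  P₂-sides true  (fs f0) f0      = refl
  P₂-sides true  (fs f0) (fs f0) = refl
  P₂-sides false f0      f0      = refl
  P₂-sides false f0      (fs f0) = refl
  P₂-sides false (fs f0) f0      = refl
  P₂-sides false (fs f0) (fs f0) = refl

c4Pos : ∀ {L} a b → a < L → b < L → Bool → Fin 4 → Vertex L
c4Pos a b a< b< su f0                = vtx a su a<
c4Pos a b a< b< su (fs f0)           = vtx b false b<
c4Pos a b a< b< su (fs (fs f0))      = vtx a (not su) a<
c4Pos a b a< b< su (fs (fs (fs _))) = vtx b true b<

C₄-square : ∀ {L} t a b (a< : a < L) (b< : b < L) su →
  (∀ s s' → ladderAdj t a s a s' ≡ false) → (∀ s s' → ladderAdj t b s b s' ≡ false) →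
  (∀ s s' → ladderAdj t a s b s' ≡ true) → (∀ s s' → ladderAdj t b s a s' ≡ true) →
  ∀ i j → C4adj i j ≡ adjV t (c4Pos a b a< b< su i) (c4Pos a b a< b< su j)
C₄-square t a b a< b< su aa bb ab ba = square
  where
  square : ∀ i j → C4adj i j ≡ adjV t (c4Pos a b a< b< su i) (c4Pos a b a< b< su j)
  square f0                f0                = sym (aa _ _)
  square f0                (fs f0)           = sym (ab _ _)
  square f0                (fs (fs f0))      = sym (aa _ _)
  square f0                (fs (fs (fs f0))) = sym (ab _ _)
  square (fs f0)           f0                = sym (ba _ _)
  square (fs f0)           (fs f0)           = sym (bb _ _)
  square (fs f0)           (fs (fs f0))      = sym (ba _ _)
  square (fs f0)           (fs (fs (fs f0))) = sym (bb _ _)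
  square (fs (fs f0))      f0                = sym (aa _ _)
  square (fs (fs f0))      (fs f0)           = sym (ab _ _)
  square (fs (fs f0))      (fs (fs f0))      = sym (aa _ _)
  square (fs (fs f0))      (fs (fs (fs f0))) = sym (ab _ _)
  square (fs (fs (fs f0))) f0                = sym (ba _ _)
  square (fs (fs (fs f0))) (fs f0)           = sym (bb _ _)
  square (fs (fs (fs f0))) (fs (fs f0))      = sym (ba _ _)
  square (fs (fs (fs f0))) (fs (fs (fs f0))) = sym (bb _ _)

A-square : ∀ {L} t a (a< : a < L) (b< : suc a < L) su → typeAt t a ≡ A →
  ∀ i j → C4adj i j ≡ adjV t (c4Pos a (suc a) a< b< su i) (c4Pos a (suc a) a< b< su j)
A-square t a a< b< su isA = C₄-square t a (suc a) a< b< su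
  (λ s s' → trans (ladder-same t a s s') (cong (λ τ → rung τ s s') isA))
  (λ s s' → trans (ladder-same t (suc a) s s') (cong (λ τ → rung τ s s') (trans (typeAt-suc t a) (cong nextTy isA))))
  (λ s s' → trans (ladder-up t a s s') (cong (λ τ → link τ s s') isA))
  (λ s s' → trans (ladder-down t a s s') (cong (λ τ → link τ s' s) isA))

topP₂ : ∀ L su → Placement 2 L (suc L)
topP₂ L su = record
  { newPos = newPos ; shift = widen ; classify = classify
  ; classify-newPos = λ i → onTop i (L ≟ℕ L)
  ; classify-shift = λ v → below v (layer v ≟ℕ L)
  ; place-classify = λ z → placed z (layer z ≟ℕ L) }
  where
  newPos = p2Pos L ≤-refl su
  classifyBy : (z : Vertex (suc L)) → Dec (layer z ≡ L) → Fin 2 ⊎ Vertex L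
  classifyBy (vtx m s _)  (yes _)   = inj₁ (pickSide su f0 (fs f0) s)
  classifyBy (vtx m s m<) (no m≢L) = inj₂ (vtx m s (≤∧≢⇒< (≤-pred m<) m≢L))
  classify : Vertex (suc L) → Fin 2 ⊎ Vertex L
  classify z = classifyBy z (layer z ≟ℕ L)
  onTop : ∀ i d → classifyBy (newPos i) d ≡ inj₁ i
  onTop i       (no L≢L) = ⊥-elim (L≢L refl)
  onTop f0      (yes _)  = cong inj₁ (pickSide-su su f0 (fs f0))
  onTop (fs f0) (yes _)  = cong inj₁ (pickSide-not su f0 (fs f0))
  below : ∀ v d → classifyBy (widen v) d ≡ inj₂ v
  below v (yes e) = ⊥-elim (<-irrefl e (layer< v))
  below v (no _)  = refl
  placed : ∀ z d → [ newPos , widen ]′ (classifyBy z d) ≡ z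
  placed (vtx m s m<) (yes refl) = pickSide-correct newPos (λ s → vtx L s m<) su refl refl s
  placed (vtx m s m<) (no _)     = refl

topC₄ : ∀ L su → Placement 4 L (suc (suc L))
topC₄ L su = record
  { newPos = newPos ; shift = widen ∘ widen ; classify = classify
  ; classify-newPos = λ i → onTop i (layer (newPos i) ≟ℕ suc L) (layer (newPos i) ≟ℕ L)
  ; classify-shift = λ v → below v (layer v ≟ℕ suc L) (layer v ≟ℕ L)
  ; place-classify = λ z → placed z (layer z ≟ℕ suc L) (layer z ≟ℕ L) }
  where
  newPos = c4Pos L (suc L) (m<n⇒m<1+n ≤-refl) ≤-refl su
  classifyBy : (z : Vertex (suc (suc L))) → Dec (layer z ≡ suc L) → Dec (layer z ≡ L) → Fin 4 ⊎ Vertex L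
  classifyBy (vtx m s _)  (yes _)    _        = inj₁ (pickSide false (fs f0) (fs (fs (fs f0))) s)
  classifyBy (vtx m s _)  (no _)     (yes _)  = inj₁ (pickSide su f0 (fs (fs f0)) s)
  classifyBy (vtx m s m<) (no m≢L+1) (no m≢L) = inj₂ (vtx m s (≤∧≢⇒< (≤-pred (≤∧≢⇒< (≤-pred m<) m≢L+1)) m≢L))
  classify : Vertex (suc (suc L)) → Fin 4 ⊎ Vertex L
  classify z = classifyBy z (layer z ≟ℕ suc L) (layer z ≟ℕ L)
  onTop : ∀ i d₁ d₂ → classifyBy (newPos i) d₁ d₂ ≡ inj₁ i
  onTop f0                (yes e) _       = ⊥-elim (1+n≢n (sym e))
  onTop f0                (no _)  (yes _) = cong inj₁ (pickSide-su su f0 (fs (fs f0)))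
  onTop f0                (no _)  (no ne) = ⊥-elim (ne refl)
  onTop (fs f0)           (yes _) _       = cong inj₁ (pickSide-su false (fs f0) (fs (fs (fs f0))))
  onTop (fs f0)           (no ne) _       = ⊥-elim (ne refl)
  onTop (fs (fs f0))      (yes e) _       = ⊥-elim (1+n≢n (sym e))
  onTop (fs (fs f0))      (no _)  (yes _) = cong inj₁ (pickSide-not su f0 (fs (fs f0)))
  onTop (fs (fs f0))      (no _)  (no ne) = ⊥-elim (ne refl)
  onTop (fs (fs (fs f0))) (yes _) _       = cong inj₁ (pickSide-not false (fs f0) (fs (fs (fs f0))))
  onTop (fs (fs (fs f0))) (no ne) _       = ⊥-elim (ne refl)
  below : ∀ v d₁ d₂ → classifyBy (widen (widen v)) d₁ d₂ ≡ inj₂ v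
  below v (yes e) _       = ⊥-elim (<-irrefl e (m<n⇒m<1+n (layer< v)))
  below v (no _)  (yes e) = ⊥-elim (<-irrefl e (layer< v))
  below v (no _)  (no _)  = refl
  placed : ∀ z d₁ d₂ → [ newPos , widen ∘ widen ]′ (classifyBy z d₁ d₂) ≡ z
  placed (vtx m s m<) (yes refl) _          = pickSide-correct newPos (λ s → vtx (suc L) s m<) false refl refl s
  placed (vtx m s m<) (no _)     (yes refl) = pickSide-correct newPos (λ s → vtx L s m<) su refl refl s
  placed (vtx m s m<) (no _)     (no _)     = refl

bottomP₂ : ∀ L su → Placement 2 L (suc L)
bottomP₂ L su = record
  { newPos = newPos ; shift = raise ; classify = classify
  ; classify-newPos = classify-newPos ; classify-shift = λ v → refl ; place-classify = place-classify }
  where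
  newPos = p2Pos 0 (s≤s z≤n) su
  classify : Vertex (suc L) → Fin 2 ⊎ Vertex L
  classify (vtx zero    s _)  = inj₁ (pickSide su f0 (fs f0) s)
  classify (vtx (suc m) s m<) = inj₂ (vtx m s (≤-pred m<))
  classify-newPos : ∀ i → classify (newPos i) ≡ inj₁ i
  classify-newPos f0      = cong inj₁ (pickSide-su su f0 (fs f0))
  classify-newPos (fs f0) = cong inj₁ (pickSide-not su f0 (fs f0))
  place-classify : ∀ z → [ newPos , raise ]′ (classify z) ≡ z
  place-classify (vtx zero    s m<) = pickSide-correct newPos (λ s → vtx 0 s m<) su refl refl s
  place-classify (vtx (suc m) s m<) = refl

bottomC₄ : ∀ L su → Placement 4 L (suc (suc L))
bottomC₄ L su = record
  { newPos = newPos ; shift = raise ∘ raise ; classify = classify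
  ; classify-newPos = classify-newPos ; classify-shift = λ v → refl ; place-classify = place-classify }
  where
  newPos = c4Pos 1 0 (s≤s (s≤s z≤n)) (s≤s z≤n) su
  classify : Vertex (suc (suc L)) → Fin 4 ⊎ Vertex L
  classify (vtx zero          s _)  = inj₁ (pickSide false (fs f0) (fs (fs (fs f0))) s)
  classify (vtx (suc zero)    s _)  = inj₁ (pickSide su f0 (fs (fs f0)) s)
  classify (vtx (suc (suc m)) s m<) = inj₂ (vtx m s (≤-pred (≤-pred m<)))
  classify-newPos : ∀ i → classify (newPos i) ≡ inj₁ i
  classify-newPos f0                = cong inj₁ (pickSide-su su f0 (fs (fs f0)))
  classify-newPos (fs f0)           = cong inj₁ (pickSide-su false (fs f0) (fs (fs (fs f0))))
  classify-newPos (fs (fs f0))      = cong inj₁ (pickSide-not su f0 (fs (fs f0)))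
  classify-newPos (fs (fs (fs f0))) = cong inj₁ (pickSide-not false (fs f0) (fs (fs (fs f0))))
  place-classify : ∀ z → [ newPos , raise ∘ raise ]′ (classify z) ≡ z
  place-classify (vtx zero          s m<) = pickSide-correct newPos (λ s → vtx 0 s m<) false refl refl s
  place-classify (vtx (suc zero)    s m<) = pickSide-correct newPos (λ s → vtx 1 s m<) su refl refl s
  place-classify (vtx (suc (suc m)) s m<) = refl

indicator-of : ∀ {n} (f : Fin n → Bool) u → f u ≡ true → (∀ w → f w ≡ true → w ≡ u) →
  ∀ w → ⌊ w ≟ u ⌋ ≡ f w
indicator-of f u fu only w with w ≟ u
... | yes refl = sym fu
... | no w≢u with f w in fw
...   | true  = ⊥-elim (w≢u (only w fw))
...   | false = refl

link-refl : ∀ {τ} s → Matched τ → link τ s s ≡ true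
link-refl s (inj₁ refl) = same-refl s
link-refl s (inj₂ refl) = same-refl s

aboveTop : ∀ t L1 s m s' → m < suc L1 → Matched (typeAt t L1) →
  ladderAdj t (suc L1) s m s' ≡ true → (m ≡ L1) × (s' ≡ s)
aboveTop t L1 s m s' m<L matched e with ladder-near t (suc L1) s m s' e
... | same-layer eq    = ⊥-elim (<-irrefl eq m<L)
... | layer-up eq      = ⊥-elim (<-irrefl eq (m<n⇒m<1+n m<L))
... | layer-down refl = refl , matching matched (trans (sym (ladder-down t m s s')) e)

-- Below layer 0, the position (-1, s) of a new layer of matched type τ
-- could only be joined to (0, s); positions are shifted up by one.
belowBottom : ∀ τ s m s' → Matched τ → fromBottom τ s (suc m) s' ≡ true → (m ≡ 0) × (s' ≡ s)
belowBottom τ s zero s' matched e = refl , sym (matching matched e)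

topHook : ∀ {H t L1} (R : IsLadder H t (suc L1)) → Matched (typeAt t L1) →
  ∀ {u su} → IsLadder.pos R u ≡ vtx L1 su ≤-refl →
  ∀ w → ⌊ w ≟ u ⌋ ≡ ladderAdj t (suc L1) su (layer (IsLadder.pos R w)) (side (IsLadder.pos R w))
topHook {H} {t} {L1} R matched {u} {su} posu =
  indicator-of (λ w → ladderAdj t (suc L1) su (layer (pos w)) (side (pos w))) u joined-u only-u
  where
  open IsLadder R
  joined-u : ladderAdj t (suc L1) su (layer (pos u)) (side (pos u)) ≡ true
  joined-u rewrite posu = trans (ladder-down t L1 su su) (link-refl su matched)
  only-u : ∀ w → ladderAdj t (suc L1) su (layer (pos w)) (side (pos w)) ≡ true → w ≡ u
  only-u w e with aboveTop t L1 su (layer (pos w)) (side (pos w)) (layer< (pos w)) matched e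
  ... | onL1 , onSu = pos-injective (trans (vertex-≡ onL1 onSu) (sym posu))

bottomHook : ∀ {H t L1} (R : IsLadder H t (suc L1)) τ → Matched τ →
  ∀ {u su} → IsLadder.pos R u ≡ vtx 0 su (s≤s z≤n) →
  ∀ w → ⌊ w ≟ u ⌋ ≡ fromBottom τ su (suc (layer (IsLadder.pos R w))) (side (IsLadder.pos R w))
bottomHook {H} {t} {L1} R τ matched {u} {su} posu =
  indicator-of (λ w → fromBottom τ su (suc (layer (pos w))) (side (pos w))) u joined-u only-u
  where
  open IsLadder R
  joined-u : fromBottom τ su (suc (layer (pos u))) (side (pos u)) ≡ true
  joined-u rewrite posu = link-refl su matched
  only-u : ∀ w → fromBottom τ su (suc (layer (pos w))) (side (pos w)) ≡ true → w ≡ u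
  only-u w e with belowBottom τ su (layer (pos w)) (side (pos w)) matched e
  ... | on0 , onSu = pos-injective (trans (vertex-≡ on0 onSu) (sym posu))

top-op1 : ∀ {H t L1 u v su} (R : IsLadder H t (suc L1)) → typeAt t L1 ≡ B →
  IsLadder.pos R u ≡ vtx L1 su ≤-refl → IsLadder.pos R v ≡ vtx L1 (not su) ≤-refl →
  IsLadder (op1Graph H u v) t (suc (suc L1))
top-op1 {H} {t} {L1} {u} {v} {su} R isB posu posv =
  Extension.extend-ladder R (topP₂ (suc L1) su) (λ _ _ → refl) (P₂-rung t (suc L1) ≤-refl su isP)
    λ { f0 w → topHook R (inj₂ isB) posu w ; (fs f0) w → topHook R (inj₂ isB) posv w }
  where
  isP : typeAt t (suc L1) ≡ P
  isP = trans (typeAt-suc t L1) (cong nextTy isB)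

top-op2 : ∀ {H t L1 u v su} (R : IsLadder H t (suc L1)) → typeAt t L1 ≡ P →
  IsLadder.pos R u ≡ vtx L1 su ≤-refl → IsLadder.pos R v ≡ vtx L1 (not su) ≤-refl →
  IsLadder (op2Graph H u v) t (suc (suc (suc L1)))
top-op2 {H} {t} {L1} {u} {v} {su} R isP posu posv =
  Extension.extend-ladder R (topC₄ (suc L1) su) (λ _ _ → refl)
    (A-square t (suc L1) _ _ su isA)
    λ { f0 w                → topHook R (inj₁ isP) posu w
      ; (fs f0) w           → sym (ladder-far t L1 false _ (≤-pred (layer< (pos w))))
      ; (fs (fs f0)) w      → topHook R (inj₁ isP) posv w
      ; (fs (fs (fs f0))) w → sym (ladder-far t L1 true _ (≤-pred (layer< (pos w)))) }
  where
  open IsLadder R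
  isA : typeAt t (suc L1) ≡ A
  isA = trans (typeAt-suc t L1) (cong nextTy isP)

bottom-op1 : ∀ {H L1 u v su} (R : IsLadder H A (suc L1)) →
  IsLadder.pos R u ≡ vtx 0 su (s≤s z≤n) → IsLadder.pos R v ≡ vtx 0 (not su) (s≤s z≤n) →
  IsLadder (op1Graph H u v) P (suc (suc L1))
bottom-op1 {H} {L1} {u} {v} {su} R posu posv =
  Extension.extend-ladder R (bottomP₂ (suc L1) su) (λ _ _ → refl) (P₂-rung {suc (suc L1)} P 0 (s≤s z≤n) su refl)
    λ { f0 w → bottomHook R P (inj₁ refl) posu w ; (fs f0) w → bottomHook R P (inj₁ refl) posv w }

bottom-op2 : ∀ {H L1 u v su} (R : IsLadder H P (suc L1)) →
  IsLadder.pos R u ≡ vtx 0 su (s≤s z≤n) → IsLadder.pos R v ≡ vtx 0 (not su) (s≤s z≤n) →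
  IsLadder (op2Graph H u v) A (suc (suc (suc L1)))
bottom-op2 {H} {L1} {u} {v} {su} R posu posv =
  Extension.extend-ladder R (bottomC₄ (suc L1) su) (λ _ _ → refl)
    (C₄-square A 1 0 _ _ su (λ _ _ → refl) (λ _ _ → refl) (λ _ _ → refl) (λ _ _ → refl))
    λ { f0 w                → bottomHook R B (inj₂ refl) posu w
      ; (fs f0) w           → refl
      ; (fs (fs f0)) w      → bottomHook R B (inj₂ refl) posv w
      ; (fs (fs (fs f0))) w → refl }

record ThreeNeighbours (t : Ty) (m : ℕ) (s : Bool) (L : ℕ) : Set where
  field
    a b c    : Vertex L
    a≢b      : a ≢ b
    a≢c      : a ≢ c
    b≢c      : b ≢ c
    a-joined : ladderAdj t m s (layer a) (side a) ≡ true
    b-joined : ladderAdj t m s (layer b) (side b) ≡ true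
    c-joined : ladderAdj t m s (layer c) (side c) ≡ true

interior-three : ∀ t m0 s L → suc (suc m0) < L → ThreeNeighbours t (suc m0) s L
interior-three t m0 s L h = byType (typeAt t m0) refl
  where
  n≢2+n : ∀ {n} → n ≢ suc (suc n)
  n≢2+n ()
  below : Bool → Vertex L
  below s' = vtx m0 s' (≤-trans (m<n⇒m<1+n (m<n⇒m<1+n ≤-refl)) h)
  here : Bool → Vertex L
  here s' = vtx (suc m0) s' (≤-trans (s≤s (m<n⇒m<1+n ≤-refl)) h)
  above : Bool → Vertex L
  above s' = vtx (suc (suc m0)) s' h
  to-below : ∀ {τ0} s' → typeAt t m0 ≡ τ0 → ladderAdj t (suc m0) s m0 s' ≡ link τ0 s' s
  to-below s' e = trans (ladder-down t m0 s s') (cong (λ τ → link τ s' s) e)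
  to-here : ∀ {τ0} s' → typeAt t m0 ≡ τ0 → ladderAdj t (suc m0) s (suc m0) s' ≡ rung (nextTy τ0) s s'
  to-here s' e = trans (ladder-same t (suc m0) s s') (cong (λ τ → rung τ s s') (trans (typeAt-suc t m0) (cong nextTy e)))
  to-above : ∀ {τ0} s' → typeAt t m0 ≡ τ0 → ladderAdj t (suc m0) s (suc (suc m0)) s' ≡ link (nextTy τ0) s s'
  to-above s' e = trans (ladder-up t (suc m0) s s') (cong (λ τ → link τ s s') (trans (typeAt-suc t m0) (cong nextTy e)))
  byType : ∀ τ0 → typeAt t m0 ≡ τ0 → ThreeNeighbours t (suc m0) s L
  byType B e = record
    { a = here (not s) ; b = below s ; c = above s
    ; a≢b = λ q → 1+n≢n (cong layer q) ; a≢c = λ q → 1+n≢n (sym (cong layer q)) ; b≢c = λ q → n≢2+n (cong layer q)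
    ; a-joined = trans (to-here (not s) e) (cong not (same-not s))
    ; b-joined = trans (to-below s e) (same-refl s)
    ; c-joined = trans (to-above s e) (same-refl s) }
  byType P e = record
    { a = below s ; b = above s ; c = above (not s)
    ; a≢b = λ q → n≢2+n (cong layer q) ; a≢c = λ q → n≢2+n (cong layer q) ; b≢c = λ q → not-fixed (cong side q)
    ; a-joined = trans (to-below s e) (same-refl s)
    ; b-joined = to-above s e
    ; c-joined = to-above (not s) e }
  byType A e = record
    { a = below s ; b = below (not s) ; c = above s
    ; a≢b = λ q → not-fixed (cong side q) ; a≢c = λ q → n≢2+n (cong layer q) ; b≢c = λ q → n≢2+n (cong layer q)
    ; a-joined = to-below s e
    ; b-joined = to-below (not s) e
    ; c-joined = trans (to-above s e) (same-refl s) }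

-- If u gains a neighbour z outside H, then u lies in the bottom or
-- top layer: an interior vertex would have four neighbours.
end-layer : ∀ {H t L1} (R : IsLadder H t (suc L1)) (G : Graph)
  (emb : Fin (size H) → Fin (size G)) (z : Fin (size G)) →
  (∀ {a b} → emb a ≡ emb b → a ≡ b) → (∀ a → emb a ≢ z) →
  (u : Fin (size H)) → (∀ w → adj G (emb u) (emb w) ≡ adj H u w) → adj G (emb u) z ≡ true →
  MaxDegAtMost3 G → layer (IsLadder.pos R u) ≡ 0 ⊎ layer (IsLadder.pos R u) ≡ L1
end-layer {H} {t} {L1} R G emb z emb-inj emb≢z u emb-adj u~z maxDeg with layer (IsLadder.pos R u) in lu
... | zero = inj₁ refl
... | suc m0 with suc m0 ≟ℕ L1
...   | yes top = inj₂ top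
...   | no ¬top = ⊥-elim (four≰three (≤-trans four (subst (_≤ 3) (degree-count G (emb u)) (maxDeg (emb u)))))
  where
  open IsLadder R
  four≰three : ¬ (4 ≤ 3)
  four≰three (s≤s (s≤s (s≤s ())))
  interior : suc (suc m0) < suc L1
  interior = s≤s (≤∧≢⇒< (≤-pred (subst (_< suc L1) lu (layer< (pos u)))) ¬top)
  open ThreeNeighbours (interior-three t m0 (side (pos u)) (suc L1) interior)
  joined : ∀ y → ladderAdj t (suc m0) (side (pos u)) (layer y) (side y) ≡ true → adj G (emb u) (emb (vertexAt y)) ≡ true
  joined y e rewrite emb-adj (vertexAt y) | adj-pos u (vertexAt y) | pos-vertexAt y | lu = e
  four : 4 ≤ count (size G) (adj G (emb u))
  four = count-four (size G) (adj G (emb u)) z (emb (vertexAt a)) (emb (vertexAt b)) (emb (vertexAt c))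
    (λ q → emb≢z _ (sym q)) (λ q → emb≢z _ (sym q)) (λ q → emb≢z _ (sym q))
    (λ q → a≢b (vertexAt-injective (emb-inj q))) (λ q → a≢c (vertexAt-injective (emb-inj q)))
    (λ q → b≢c (vertexAt-injective (emb-inj q)))
    u~z (joined a a-joined) (joined b b-joined) (joined c c-joined)

EndLayer : ℕ → ℕ → Set
EndLayer L1 m = m ≡ 0 ⊎ m ≡ L1

edge-at-ends : ∀ t L1 mu su mv sv → 2 ≤ L1 → EndLayer L1 mu → EndLayer L1 mv →
  ladderAdj t mu su mv sv ≡ true → (mv ≡ mu) × (typeAt t mu ≡ P) × (sv ≡ not su)
edge-at-ends t L1 .0 su .0 sv _ (inj₁ refl) (inj₁ refl) e = refl , rung-true t su sv e
edge-at-ends t L1 .L1 su .L1 sv _ (inj₂ refl) (inj₂ refl) e =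
  refl , rung-true (typeAt t L1) su sv (trans (sym (ladder-same t L1 su sv)) e)
edge-at-ends t .(suc (suc _)) .0 su .(suc (suc _)) sv (s≤s (s≤s _)) (inj₁ refl) (inj₂ refl) ()
edge-at-ends t .(suc (suc _)) .(suc (suc _)) su .0 sv (s≤s (s≤s _)) (inj₂ refl) (inj₁ refl) ()

bridgeSide : Ty → Bool → Bool → Bool
bridgeSide A su sv = sv
bridgeSide _ su sv = su

bridge : ∀ t L1 → (t ≡ P ⊎ t ≡ A) → 2 ≤ L1 → ∀ su sv mw sw →
  ladderAdj t 0 su mw sw ≡ true → ladderAdj t mw sw L1 sv ≡ true → (mw ≡ 1) × (sw ≡ bridgeSide t su sv)
bridge t zero                _           ()            su sv mw         sw _  _
bridge t (suc zero)          _           (s≤s ())      su sv mw         sw _  _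
bridge t (suc (suc d))       _           _             su sv zero       sw _  ()
bridge t (suc (suc zero))    (inj₁ refl) _             su sv (suc zero) sw e₁ e₂ = refl , sym (same⇒≡ e₁)
bridge t (suc (suc zero))    (inj₂ refl) _             su sv (suc zero) sw e₁ e₂ = refl , same⇒≡ e₂
bridge t (suc (suc (suc d))) _           _             su sv (suc zero) sw e₁ ()

-- If the opposite vertices u, v of a 4-cycle u w v x both lie in end
-- layers of a ladder with at least three layers starting with a P- or
-- A-layer, they are the two vertices of one end layer, which is not a
-- P-layer (the ends of a rung have no common neighbour).
square-at-ends : ∀ t L1 mu su mv sv mw sw mx sx → 2 ≤ L1 → (t ≡ P ⊎ t ≡ A) →
  EndLayer L1 mu → EndLayer L1 mv → (mu ≡ mv → su ≡ sv → ⊥) →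
  ladderAdj t mu su mw sw ≡ true → ladderAdj t mw sw mv sv ≡ true →
  ladderAdj t mv sv mx sx ≡ true → ladderAdj t mx sx mu su ≡ true → (mw ≡ mx → sw ≡ sx → ⊥) →
  (mv ≡ mu) × (sv ≡ not su) × (typeAt t mu ≢ P)
square-at-ends t L1 mu su mv sv mw sw mx sx L1≥2 start endU endV u≢v uw wv vx xu w≢x = cases endU endV
  where
  sameLayer : mu ≡ mv → (mv ≡ mu) × (sv ≡ not su) × (typeAt t mu ≢ P)
  sameLayer refl = refl , otherSide , λ isP → rung-triangle-free t mu su sv mw sw
    (trans (ladder-same t mu su sv) (trans (cong (λ τ → rung τ su sv) isP)
      (subst (λ s' → rung P su s' ≡ true) (sym otherSide) (cong not (same-not su)))))
    (trans (ladder-sym t mw sw mu su) uw) wv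
    where
    otherSide : sv ≡ not su
    otherSide with same su sv in e
    ... | true  = ⊥-elim (u≢v refl (same⇒≡ e))
    ... | false = different⇒not e
  cases : EndLayer L1 mu → EndLayer L1 mv → (mv ≡ mu) × (sv ≡ not su) × (typeAt t mu ≢ P)
  cases (inj₁ p) (inj₁ q) = sameLayer (trans p (sym q))
  cases (inj₂ p) (inj₂ q) = sameLayer (trans p (sym q))
  cases (inj₁ refl) (inj₂ refl) = ⊥-elim (w≢x (trans (proj₁ viaW) (sym (proj₁ viaX))) (trans (proj₂ viaW) (sym (proj₂ viaX))))
    where
    viaW = bridge t L1 start L1≥2 su sv mw sw uw wv
    viaX = bridge t L1 start L1≥2 su sv mx sx (trans (ladder-sym t 0 su mx sx) xu) (trans (ladder-sym t mx sx L1 sv) vx)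
  cases (inj₂ refl) (inj₁ refl) = ⊥-elim (w≢x (trans (proj₁ viaW) (sym (proj₁ viaX))) (trans (proj₂ viaW) (sym (proj₂ viaX))))
    where
    viaW = bridge t L1 start L1≥2 sv su mw sw (trans (ladder-sym t 0 sv mw sw) wv) (trans (ladder-sym t mw sw L1 su) uw)
    viaX = bridge t L1 start L1≥2 sv su mx sx vx xu

data Block : Set where
  p2 c4 : Block

other : Block → Block
other p2 = c4
other c4 = p2

firstType : Block → Ty
firstType p2 = P
firstType c4 = A

blockSize : Block → ℕ
blockSize p2 = 1
blockSize c4 = 2

blockAt : Block → ℕ → Block
blockAt r zero    = r
blockAt r (suc k) = blockAt (other r) k

layers : Block → ℕ → ℕ
layers r zero    = 0
layers r (suc n) = blockSize r + layers (other r) n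

BlockLadder : Block → ℕ → Graph → Set
BlockLadder r n H = IsLadder H (firstType r) (layers r n)

blockAt-suc : ∀ r k → blockAt r (suc k) ≡ other (blockAt r k)
blockAt-suc r zero    = refl
blockAt-suc r (suc k) = blockAt-suc (other r) k

layers-suc : ∀ r n → layers r (suc n) ≡ layers r n + blockSize (blockAt r n)
layers-suc r zero    = +-comm (blockSize r) 0
layers-suc r (suc n) = trans (cong (blockSize r +_) (layers-suc (other r) n)) (sym (+-assoc (blockSize r) _ _))

typeAt-layers : ∀ r k → typeAt (firstType r) (layers r k) ≡ firstType (blockAt r k)
typeAt-layers r  zero    = refl
typeAt-layers p2 (suc k) = typeAt-layers c4 k
typeAt-layers c4 (suc k) = typeAt-layers p2 k

layers-next : ∀ r n {κ m} → blockAt r n ≡ κ → layers r n ≡ m → layers r (suc n) ≡ m + blockSize κ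
layers-next r n last count = trans (layers-suc r n) (cong₂ (λ m κ → m + blockSize κ) count last)

data TopShape (t : Ty) (L1 L' : ℕ) (κ : Block) : Set where
  ends-with-p2 : κ ≡ p2 → typeAt t L1 ≡ P → L' ≡ suc (suc (suc L1)) → TopShape t L1 L' κ
  ends-with-c4 : κ ≡ c4 → typeAt t L1 ≡ B → L' ≡ suc (suc L1) → TopShape t L1 L' κ

record TopBlock (r : Block) (j : ℕ) : Set where
  field
    L1          : ℕ
    layers≡     : layers r (suc (suc j)) ≡ suc L1
    threeLayers : 2 ≤ L1
    shape       : TopShape (firstType r) L1 (layers r (suc (suc (suc j)))) (blockAt r (suc j))

topBlock : ∀ r j → TopBlock r j
topBlock r j with blockAt r (suc j) in last
... | p2 = record
  { L1 = M ; layers≡ = total ; threeLayers = atLeastTwo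
  ; shape = ends-with-p2 last (trans (typeAt-layers r (suc j)) (cong firstType last))
      (trans (layers-next r (suc (suc j)) next-c4 total) (+-comm (suc M) 2)) }
  where
  M = layers r (suc j)
  total : layers r (suc (suc j)) ≡ suc M
  total = trans (layers-next r (suc j) last refl) (+-comm M 1)
  next-c4 : blockAt r (suc (suc j)) ≡ c4
  next-c4 = trans (blockAt-suc r (suc j)) (cong other last)
  before-c4 : ∀ κ → other κ ≡ p2 → κ ≡ c4
  before-c4 c4 _ = refl
  atLeastTwo : 2 ≤ M
  atLeastTwo = subst (2 ≤_) (sym (layers-next r j (before-c4 _ (trans (sym (blockAt-suc r j)) last)) refl))
    (m≤n+m 2 (layers r j))
... | c4 = record
  { L1 = suc M ; layers≡ = total ; threeLayers = s≤s (positive r j)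
  ; shape = ends-with-c4 last (trans (typeAt-suc (firstType r) M) (cong nextTy isA))
      (trans (layers-next r (suc (suc j)) next-p2 total) (+-comm (suc (suc M)) 1)) }
  where
  M = layers r (suc j)
  total : layers r (suc (suc j)) ≡ suc (suc M)
  total = trans (layers-next r (suc j) last refl) (+-comm M 2)
  next-p2 : blockAt r (suc (suc j)) ≡ p2
  next-p2 = trans (blockAt-suc r (suc j)) (cong other last)
  isA : typeAt (firstType r) M ≡ A
  isA = trans (typeAt-layers r (suc j)) (cong firstType last)
  positive : ∀ r j → 1 ≤ layers r (suc j)
  positive p2 j = s≤s z≤n
  positive c4 j = s≤s z≤n

⌊⌋-self : ∀ {n} (u : Fin n) → ⌊ u ≟ u ⌋ ≡ true
⌊⌋-self u = trans (isYes≗does (u ≟ u)) (dec-true (u ≟ u) refl)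

bottom-step2 : ∀ r {j H L1 u v su} → layers r (suc (suc j)) ≡ suc L1 →
  (R : IsLadder H (firstType r) (suc L1)) → firstType r ≡ P →
  IsLadder.pos R u ≡ vtx 0 su (s≤s z≤n) → IsLadder.pos R v ≡ vtx 0 (not su) (s≤s z≤n) →
  Σ Block λ r' → BlockLadder r' (suc (suc (suc j))) (op2Graph H u v)
bottom-step2 p2 {H = H} {u = u} {v} total R _ posu posv =
  c4 , subst (IsLadder (op2Graph H u v) A) (cong (suc ∘ suc) (sym total)) (bottom-op2 R posu posv)

bottom-step1 : ∀ r {j H L1 u v su} → layers r (suc (suc j)) ≡ suc L1 →
  (R : IsLadder H (firstType r) (suc L1)) → firstType r ≢ P →
  IsLadder.pos R u ≡ vtx 0 su (s≤s z≤n) → IsLadder.pos R v ≡ vtx 0 (not su) (s≤s z≤n) →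
  Σ Block λ r' → BlockLadder r' (suc (suc (suc j))) (op1Graph H u v)
bottom-step1 p2 total R notP posu posv = ⊥-elim (notP refl)
bottom-step1 c4 {H = H} {u = u} {v} total R _ posu posv =
  p2 , subst (IsLadder (op1Graph H u v) P) (cong suc (sym total)) (bottom-op1 R posu posv)

-- Operation 2 on a block ladder: the edge uv gets a neighbour on each end,
-- so both ends lie in end layers; hence uv is the rung of an end P-layer
-- and the new C₄ becomes a new block at that end.
step-op2 : ∀ {r j H u v} → BlockLadder r (suc (suc j)) H → Adj H u v → MaxDegAtMost3 (op2Graph H u v) →
  Σ Block λ r' → BlockLadder r' (suc (suc (suc j))) (op2Graph H u v)
step-op2 {r} {j} {H} {u} {v} R₀ u~v maxDeg =
  attach (edge-at-ends t L1 _ _ _ _ threeLayers endU endV (trans (sym (adj-pos u v)) u~v)) endU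
  where
  open TopBlock (topBlock r j)
  t = firstType r
  R = subst (IsLadder H t) layers≡ R₀
  open IsLadder R
  G = op2Graph H u v
  emb : Fin (size H) → Fin (size G)
  emb y = fs (fs (fs (fs y)))
  endU = end-layer R G emb f0 (λ { refl → refl }) (λ _ ()) u (λ _ → refl) (⌊⌋-self u) maxDeg
  endV = end-layer R G emb (fs (fs f0)) (λ { refl → refl }) (λ _ ()) v (λ _ → refl) (⌊⌋-self v) maxDeg
  mu = layer (pos u)
  su = side (pos u)
  attach : (layer (pos v) ≡ mu) × (typeAt t mu ≡ P) × (side (pos v) ≡ not su) → EndLayer L1 mu →
    Σ Block λ r' → BlockLadder r' (suc (suc (suc j))) G
  attach (vLayer , isP , vSide) (inj₁ bottom) =
    bottom-step2 r {j} layers≡ R (subst (λ m → typeAt t m ≡ P) bottom isP)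
      (vertex-≡ bottom refl) (vertex-≡ (trans vLayer bottom) vSide)
  attach (vLayer , isP , vSide) (inj₂ top) with shape
  ... | ends-with-p2 _ topP grown =
    r , subst (IsLadder G t) (sym grown) (top-op2 R topP (vertex-≡ top refl) (vertex-≡ (trans vLayer top) vSide))
  ... | ends-with-c4 _ topB _ = ⊥-elim (P≢B (trans (sym isP) (trans (cong (typeAt t) top) topB)))
    where
    P≢B : P ≢ B
    P≢B ()

-- Operation 1 on a block ladder: the opposite vertices u, v of the 4-cycle
-- u w v x get new neighbours, so they lie in end layers; hence they form an
-- end layer of a C₄-block and the new P₂ becomes a new block at that end.
step-op1 : ∀ {r j H u v} → BlockLadder r (suc (suc j)) H → OppositeIn4Cycle H u v →
  MaxDegAtMost3 (op1Graph H u v) → Σ Block λ r' → BlockLadder r' (suc (suc (suc j))) (op1Graph H u v)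
step-op1 {r} {j} {H} {u} {v} R₀ (w , x , _ , u≢v , _ , _ , w≢x , _ , u~w , w~v , v~x , x~u) maxDeg =
  attach (square-at-ends t L1 _ _ _ _ _ _ _ _ threeLayers (start r) endU endV
            (λ p q → u≢v (pos-injective (vertex-≡ p q)))
            (inLadder u~w) (inLadder w~v) (inLadder v~x) (inLadder x~u)
            (λ p q → w≢x (pos-injective (vertex-≡ p q))))
    endU
  where
  open TopBlock (topBlock r j)
  t = firstType r
  R = subst (IsLadder H t) layers≡ R₀
  open IsLadder R
  G = op1Graph H u v
  emb : Fin (size H) → Fin (size G)
  emb y = fs (fs y)
  endU = end-layer R G emb f0 (λ { refl → refl }) (λ _ ()) u (λ _ → refl) (⌊⌋-self u) maxDeg
  endV = end-layer R G emb (fs f0) (λ { refl → refl }) (λ _ ()) v (λ _ → refl) (⌊⌋-self v) maxDeg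
  inLadder : ∀ {a b} → Adj H a b → adjV t (pos a) (pos b) ≡ true
  inLadder {a} {b} e = trans (sym (adj-pos a b)) e
  start : ∀ r → firstType r ≡ P ⊎ firstType r ≡ A
  start p2 = inj₁ refl
  start c4 = inj₂ refl
  mu = layer (pos u)
  su = side (pos u)
  attach : (layer (pos v) ≡ mu) × (side (pos v) ≡ not su) × (typeAt t mu ≢ P) → EndLayer L1 mu →
    Σ Block λ r' → BlockLadder r' (suc (suc (suc j))) G
  attach (vLayer , vSide , notP) (inj₁ bottom) =
    bottom-step1 r {j} layers≡ R (λ isP → notP (subst (λ m → typeAt t m ≡ P) (sym bottom) isP))
      (vertex-≡ bottom refl) (vertex-≡ (trans vLayer bottom) vSide)
  attach (vLayer , vSide , notP) (inj₂ top) with shape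
  ... | ends-with-p2 _ topP _ = ⊥-elim (notP (trans (cong (typeAt t) top) topP))
  ... | ends-with-c4 _ topB grown =
    r , subst (IsLadder G t) (sym grown) (top-op1 R topB (vertex-≡ top refl) (vertex-≡ (trans vLayer top) vSide))

step-ladder : ∀ {r j o H G} → BlockLadder r (suc (suc j)) H → Step o H G → MaxDegAtMost3 G →
  Σ Block λ r' → BlockLadder r' (suc (suc (suc j))) G
step-ladder {r} {j} R (step1 u v opposite) maxDeg = step-op1 {r} {j} R opposite maxDeg
step-ladder {r} {j} R (step2 u v u~v)      maxDeg = step-op2 {r} {j} R u~v maxDeg

-- L₀ is the ladder P A B: the rung 1-2 is layer 0, the vertices 0, 3 form
-- the A-layer and 4, 5 the B-layer (0 4 3 5 is the C₄).
L0-ladder : BlockLadder p2 2 L0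
L0-ladder = record
  { pos = pos0 ; vertexAt = vertexAt0 ; vertexAt-pos = vertexAt-pos0 ; pos-vertexAt = pos-vertexAt0
  ; adj-pos = toWitness {a? = all? λ x → all? λ y → adj L0 x y ≟B adjV P (pos0 x) (pos0 y)} tt }
  where
  beyond : ∀ {m} → suc (suc (suc m)) < 3 → ⊥
  beyond (s≤s (s≤s (s≤s ())))
  pos0 : Fin 6 → Vertex 3
  pos0 f0                          = vtx 1 false (s≤s (s≤s z≤n))
  pos0 (fs f0)                     = vtx 0 false (s≤s z≤n)
  pos0 (fs (fs f0))                = vtx 0 true (s≤s z≤n)
  pos0 (fs (fs (fs f0)))           = vtx 1 true (s≤s (s≤s z≤n))
  pos0 (fs (fs (fs (fs f0))))      = vtx 2 false (s≤s (s≤s (s≤s z≤n)))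
  pos0 (fs (fs (fs (fs (fs f0))))) = vtx 2 true (s≤s (s≤s (s≤s z≤n)))
  vertexAt0 : Vertex 3 → Fin 6
  vertexAt0 (vtx 0 false _) = fs f0
  vertexAt0 (vtx 0 true  _) = fs (fs f0)
  vertexAt0 (vtx 1 false _) = f0
  vertexAt0 (vtx 1 true  _) = fs (fs (fs f0))
  vertexAt0 (vtx 2 false _) = fs (fs (fs (fs f0)))
  vertexAt0 (vtx 2 true  _) = fs (fs (fs (fs (fs f0))))
  vertexAt0 v@(vtx (suc (suc (suc _))) _ _) = ⊥-elim (beyond (layer< v))
  vertexAt-pos0 : ∀ x → vertexAt0 (pos0 x) ≡ x
  vertexAt-pos0 = toWitness {a? = all? λ x → vertexAt0 (pos0 x) ≟ x} tt
  pos-vertexAt0 : ∀ v → pos0 (vertexAt0 v) ≡ v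
  pos-vertexAt0 (vtx 0 false _) = refl
  pos-vertexAt0 (vtx 0 true  _) = refl
  pos-vertexAt0 (vtx 1 false _) = refl
  pos-vertexAt0 (vtx 1 true  _) = refl
  pos-vertexAt0 (vtx 2 false _) = refl
  pos-vertexAt0 (vtx 2 true  _) = refl
  pos-vertexAt0 v@(vtx (suc (suc (suc _))) _ _) = ⊥-elim (beyond (layer< v))

derived-ladder : ∀ {as H} → Derives as H → Σ Block λ r → BlockLadder r (suc (suc (length as))) H
derived-ladder base = p2 , L0-ladder
derived-ladder (next {as} {o} derivation step _ maxDeg) with derived-ladder derivation
... | r , R with step-ladder {r} {length as} R step maxDeg
...   | r' , R' = r' , subst (λ n → BlockLadder r' (suc (suc n)) _) (sym length-snoc) R'
  where
  length-snoc : length (as ∷ʳ o) ≡ suc (length as)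
  length-snoc = trans (length-++ as) (+-comm (length as) 1)

top-square : ∀ {H t L1} (R : IsLadder H t (suc L1)) → 1 ≤ L1 → typeAt t L1 ≡ B →
  let open IsLadder R in
  OppositeIn4Cycle H (vertexAt (vtx L1 false ≤-refl)) (vertexAt (vtx L1 true ≤-refl))
top-square {H} {t} {suc B0} R (s≤s z≤n) isB =
  mid false , mid true ,
  (λ q → 1+n≢n (cong layer (vertexAt-injective q))) , (λ q → false≢true (cong side (vertexAt-injective q))) ,
  (λ q → 1+n≢n (cong layer (vertexAt-injective q))) , (λ q → 1+n≢n (sym (cong layer (vertexAt-injective q)))) ,
  (λ q → false≢true (cong side (vertexAt-injective q))) , (λ q → 1+n≢n (cong layer (vertexAt-injective q))) ,
  down false false , up false true , down true true , up true false
  where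
  open IsLadder R
  isA : typeAt t B0 ≡ A
  isA = typeAt-pred t B0 isB
  top mid : Bool → Fin (size H)
  top s = vertexAt (vtx (suc B0) s ≤-refl)
  mid s = vertexAt (vtx B0 s (m<n⇒m<1+n ≤-refl))
  down : ∀ s s' → Adj H (top s) (mid s')
  down s s' = trans (adj-vertexAt _ _) (trans (ladder-down t B0 s s') (cong (λ τ → link τ s' s) isA))
  up : ∀ s s' → Adj H (mid s) (top s')
  up s s' = trans (adj-vertexAt _ _) (trans (ladder-up t B0 s s') (cong (λ τ → link τ s s') isA))

opAfter : Block → Op
opAfter p2 = op2
opAfter c4 = op1

opAfter-other : ∀ κ → opAfter (other κ) ≡ flipOp (opAfter κ)
opAfter-other p2 = refl
opAfter-other c4 = refl

Canonical : Block → ℕ → List Op → Set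
Canonical r j as = Σ Graph λ G → Derives as G × BlockLadder r (suc (suc j)) G

grow : ∀ {r j as} → Canonical r j as → Canonical r (suc j) (as ∷ʳ opAfter (blockAt r (suc j)))
grow {r} {j} {as} (G , derivation , R₀) = onTop shape
  where
  open TopBlock (topBlock r j)
  t = firstType r
  R = subst (IsLadder G t) layers≡ R₀
  open IsLadder R
  u v : Fin (size G)
  u = vertexAt (vtx L1 false ≤-refl)
  v = vertexAt (vtx L1 true ≤-refl)
  posu = pos-vertexAt (vtx L1 false ≤-refl)
  posv = pos-vertexAt (vtx L1 true ≤-refl)
  onTop : TopShape t L1 (layers r (suc (suc (suc j)))) (blockAt r (suc j)) →
    Canonical r (suc j) (as ∷ʳ opAfter (blockAt r (suc j)))
  onTop (ends-with-p2 last isP grown) = subst (λ κ → Canonical r (suc j) (as ∷ʳ opAfter κ)) (sym last)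
    (op2Graph G u v , next derivation (step2 u v rung-uv) (ladder⇒triangle-free R') (ladder⇒maxDeg3 R') ,
     subst (IsLadder _ t) (sym grown) R')
    where
    R' = top-op2 R isP posu posv
    rung-uv : Adj G u v
    rung-uv = trans (adj-vertexAt _ _) (trans (ladder-same t L1 false true) (cong (λ τ → rung τ false true) isP))
  onTop (ends-with-c4 last isB grown) = subst (λ κ → Canonical r (suc j) (as ∷ʳ opAfter κ)) (sym last)
    (op1Graph G u v , next derivation (step1 u v (top-square R (≤-trans (s≤s z≤n) threeLayers) isB))
       (ladder⇒triangle-free R') (ladder⇒maxDeg3 R') ,
     subst (IsLadder _ t) (sym grown) R')
    where
    R' = top-op1 R isB posu posv

alternating : Op → ℕ → List Op
alternating o zero    = []
alternating o (suc n) = o ∷ alternating (flipOp o) n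

alternating-length : ∀ o n → length (alternating o n) ≡ n
alternating-length o zero    = refl
alternating-length o (suc n) = cong suc (alternating-length (flipOp o) n)

alternating-alternates : ∀ o n → Alternating (alternating o n)
alternating-alternates o zero          = tt
alternating-alternates o (suc zero)    = tt
alternating-alternates o (suc (suc n)) = refl , alternating-alternates (flipOp o) (suc n)

grow-n : ∀ {r} n {j as} → Canonical r j as →
  Canonical r (n + j) (as ++ alternating (opAfter (blockAt r (suc j))) n)
grow-n {r} zero {j} {as} c = subst (Canonical r j) (sym (++-identityʳ as)) c
grow-n {r} (suc n) {j} {as} c = subst₂ (Canonical r) (+-suc n j) operations (grow-n n (grow {r} {j} c))
  where
  o = opAfter (blockAt r (suc j))
  operations : (as ∷ʳ o) ++ alternating (opAfter (blockAt r (suc (suc j)))) n ≡ as ++ alternating o (suc n)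
  operations = trans (++-assoc as (o ∷ []) _)
    (cong (λ o' → as ++ (o ∷ alternating o' n)) (trans (cong opAfter (blockAt-suc r (suc j))) (opAfter-other _)))

-- The canonical starting points: L₀ itself (first block p2), and L₀ with
-- a C₄-block added below its rung by operation 2 (first block c4).
from-L0 : Canonical p2 0 []
from-L0 = L0 , base , L0-ladder

from-L0-below : Canonical c4 1 (op2 ∷ [])
from-L0-below = op2Graph L0 (fs f0) (fs (fs f0)) ,
  next base (step2 (fs f0) (fs (fs f0)) refl) (ladder⇒triangle-free R₁) (ladder⇒maxDeg3 R₁) , R₁
  where
  R₁ = bottom-op2 {su = false} L0-ladder refl refl

canonical : ∀ r t → 1 ≤ t → Σ Op λ o → Canonical r t (alternating o t)
canonical p2 t       _ = op1 , subst (λ n → Canonical p2 n (alternating op1 t)) (+-identityʳ t) (grow-n t from-L0)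
canonical c4 (suc n) _ = op2 , subst (λ k → Canonical c4 k (alternating op2 (suc n))) (+-comm n 1) (grow-n n from-L0-below)

lemma11 : (t : ℕ) → 1 ≤ t → (H : Graph) → InL t H →
    Σ (List Op) λ as → (length as ≡ t) × Alternating as ×
      Σ Graph λ G → Derives as G × (H ≅ G)
lemma11 t 1≤t H (as , length≡t , derivation) with derived-ladder derivation
... | r , R with canonical r t 1≤t
...   | o , G , derivationG , RG =
  alternating o t , alternating-length o t , alternating-alternates o t , G , derivationG ,
  ladder-iso (subst (λ n → BlockLadder r (suc (suc n)) H) length≡t R) RG
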